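{- Let $\mathcal D$ be a strongly first order generalized dependency. Then $\mathcal D$ is first order.
   Context: Team Semantics: all first-order models have domains with at least two elements; first-order formulas are in negation normal form. A team $X$ over a model $\mathfrak M$ with domain $M$ is a set of assignments $s:V\to M$ for a fixed finite set of variables $V$; $X(\bar v)=\{s(\bar v):s\in X\}$. Satisfaction $\mathfrak M\models_X\phi$: for a first-order literal $\alpha$, iff $\mathfrak M\models_s\alpha$ for all $s\in X$; $\phi_1\vee\phi_2$ iff $X=Y\cup Z$ with $\mathfrak M\models_Y\phi_1$, $\mathfrak M\models_Z\phi_2$; $\phi_1\wedge\phi_2$ iff both hold; $\exists v\psi$ iff there is $H:X\to\mathcal P(M)\setminus\{\emptyset\}$ with $\mathfrak M\models_{X[H/v]}\psi$, $X[H/v]=\{s[m/v]:s\in X,m\in H(s)\}$; $\forall v\psi$ iff $\mathfrak M\models_{X[M/v]}\psi$, $X[M/v]=\{s[m/v]:s\in X,m\in M\}$. A sentence is true in $\mathfrak M$ iff satisfied by $\{\emptyset\}$. A $k$-ary generalized dependency is a class $\mathcal D$ of structures $(M,R)$, $R\subseteq M^k$, closed under isomorphism; the atom $\mathcal D\bar x$ is satisfied by $X$ iff $(M,X(\bar x))\in\mathcal D$. $\mathcal D$ is strongly first order if every sentence of $\mathrm{FO}(\mathcal D)$ (first-order logic with Team Semantics plus this atom) is equivalent to a first-order sentence. $\mathcal D$ is first order if there is a first-order sentence $\mathcal D(R)$ over $\{R\}$ such that $\mathcal D=\{(M,R):(M,R)\models\mathcal D(R)\}$. -}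

module Defs where

open import Data.Nat using (ℕ; zero; suc)
open import Data.Fin using (Fin)
open import Data.List using (List; []; _∷_; length; lookup)
open import Data.Vec using (Vec; map) renaming (lookup to vlookup; _∷_ to _∷ᵥ_)
open import Data.Bool using (Bool; true; false)
open import Data.Product using (Σ; _×_; ∃; _,_)
open import Data.Sum using (_⊎_)
open import Data.Unit using (⊤)
open import Relation.Nullary using (¬_)
open import Relation.Binary.PropositionalEquality using (_≡_; _≢_)
open import Function.Bundles using (_⇔_; _↔_; Inverse)
open import Level using (Lift)

Lift′ : Set → Set₁
Lift′ A = Lift _ A

-- Relational vocabularies: a list of arities; relation symbols are indices.
Sig : Set
Sig = List ℕ

Sym : Sig → Set
Sym σ = Fin (length σ)

ar : (σ : Sig) → Sym σ → ℕ
ar σ i = lookup σ i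

record Model (σ : Sig) : Set₁ where
  field
    Dom : Set
    interp : (i : Sym σ) → Vec Dom (ar σ i) → Set
open Model public

-- Standing assumption: domains have at least two elements.
TwoElems : Set → Set
TwoElems M = Σ M λ a → Σ M λ b → a ≢ b

-- A k-ary generalized dependency: a class of structures (M , R), R ⊆ M^k.
Dependency : ℕ → Set₁
Dependency k = (M : Set) → (Vec M k → Set) → Set

IsoClosed : ∀ {k} → Dependency k → Set₁
IsoClosed {k} D = ∀ (M M' : Set) (f : M ↔ M') (R : Vec M k → Set) (R' : Vec M' k → Set) →
  (∀ t → R t ⇔ R' (map (Inverse.to f) t)) → D M R → D M' R'

-- Formulas in negation normal form, de Bruijn variables (Fin n = free variables).
-- The Bool flag says whether the dependency atom D x̄ may occur:
-- Fml σ k true n = FO(D) formulas, Fml σ k false n = first-order formulas.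
data Fml (σ : Sig) (k : ℕ) : Bool → ℕ → Set where
  rel  : ∀ {b n} (i : Sym σ) → Vec (Fin n) (ar σ i) → Fml σ k b n
  nrel : ∀ {b n} (i : Sym σ) → Vec (Fin n) (ar σ i) → Fml σ k b n
  eq   : ∀ {b n} → Fin n → Fin n → Fml σ k b n
  neq  : ∀ {b n} → Fin n → Fin n → Fml σ k b n
  dep  : ∀ {n} → Vec (Fin n) k → Fml σ k true n
  or   : ∀ {b n} → Fml σ k b n → Fml σ k b n → Fml σ k b n
  and  : ∀ {b n} → Fml σ k b n → Fml σ k b n → Fml σ k b n
  ex   : ∀ {b n} → Fml σ k b (suc n) → Fml σ k b n   -- binds variable zero
  all  : ∀ {b n} → Fml σ k b (suc n) → Fml σ k b n

FO : Sig → ℕ → Set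
FO σ n = Fml σ 0 false n

tarski : ∀ {σ k n} (𝓜 : Model σ) → Fml σ k false n → Vec (Dom 𝓜) n → Set
tarski 𝓜 (rel i xs)  s = interp 𝓜 i (map (vlookup s) xs)
tarski 𝓜 (nrel i xs) s = ¬ interp 𝓜 i (map (vlookup s) xs)
tarski 𝓜 (eq x y)    s = vlookup s x ≡ vlookup s y
tarski 𝓜 (neq x y)   s = vlookup s x ≢ vlookup s y
tarski 𝓜 (or φ ψ)    s = tarski 𝓜 φ s ⊎ tarski 𝓜 ψ s
tarski 𝓜 (and φ ψ)   s = tarski 𝓜 φ s × tarski 𝓜 ψ s
tarski 𝓜 (ex φ)      s = Σ (Dom 𝓜) λ m → tarski 𝓜 φ (m ∷ᵥ s)
tarski 𝓜 (all φ)     s = (m : Dom 𝓜) → tarski 𝓜 φ (m ∷ᵥ s)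

TrueFO : ∀ {σ k} (𝓜 : Model σ) → Fml σ k false 0 → Set
TrueFO 𝓜 φ = tarski 𝓜 φ Data.Vec.[]

-- Teams over variables Fin n: sets (predicates) of assignments.
Team : Set → ℕ → Set₁
Team M n = Vec M n → Set

teamSat : ∀ {σ k b n} (𝓜 : Model σ) (D : Dependency k) →
          Fml σ k b n → Team (Dom 𝓜) n → Set₁
teamSat 𝓜 D (rel i xs)  X = Lift′ (∀ s → X s → interp 𝓜 i (map (vlookup s) xs))
teamSat 𝓜 D (nrel i xs) X = Lift′ (∀ s → X s → ¬ interp 𝓜 i (map (vlookup s) xs))
teamSat 𝓜 D (eq x y)    X = Lift′ (∀ s → X s → vlookup s x ≡ vlookup s y)
teamSat 𝓜 D (neq x y)   X = Lift′ (∀ s → X s → vlookup s x ≢ vlookup s y)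
-- (M , X(x̄)) ∈ D, where X(x̄) = { s(x̄) : s ∈ X }
teamSat 𝓜 D (dep xs)    X = Lift′ (D (Dom 𝓜) (λ t → Σ _ λ s → X s × map (vlookup s) xs ≡ t))
-- X = Y ∪ Z with Y ⊨ φ, Z ⊨ ψ
teamSat 𝓜 D (or φ ψ)    X =
  Σ (Team (Dom 𝓜) _) λ Y → Σ (Team (Dom 𝓜) _) λ Z →
    (∀ s → X s ⇔ (Y s ⊎ Z s)) × teamSat 𝓜 D φ Y × teamSat 𝓜 D ψ Z
teamSat 𝓜 D (and φ ψ)   X = teamSat 𝓜 D φ X × teamSat 𝓜 D ψ X
-- H : X → P(M) ∖ {∅}, and X[H/v] ⊨ φ
teamSat 𝓜 D (ex φ)      X =
  Σ (Vec (Dom 𝓜) _ → Dom 𝓜 → Set) λ H →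
    (∀ s → X s → Σ (Dom 𝓜) (H s)) ×
    teamSat 𝓜 D φ (λ t → Σ _ λ s → X s × Σ (Dom 𝓜) λ m → H s m × t ≡ m ∷ᵥ s)
-- X[M/v] ⊨ φ
teamSat 𝓜 D (all φ)     X =
  teamSat 𝓜 D φ (λ t → Σ _ λ s → X s × Σ (Dom 𝓜) λ m → t ≡ m ∷ᵥ s)

-- A sentence of FO(D) is true iff satisfied by the team {∅}.
TrueTeam : ∀ {σ k} (𝓜 : Model σ) (D : Dependency k) → Fml σ k true 0 → Set₁
TrueTeam 𝓜 D φ = teamSat 𝓜 D φ (λ _ → ⊤)

StronglyFO : ∀ {k} → Dependency k → Set₁
StronglyFO {k} D = ∀ (σ : Sig) (φ : Fml σ k true 0) →
  Σ (FO σ 0) λ ψ → ∀ (𝓜 : Model σ) → TwoElems (Dom 𝓜) →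
    (TrueTeam 𝓜 D φ ⇔ TrueFO 𝓜 ψ)

structModel : ∀ {k} (M : Set) → (Vec M k → Set) → Model (k ∷ [])
structModel M R = record { Dom = M ; interp = λ { Fin.zero → R } }
  where import Data.Fin as Fin

FirstOrder : ∀ {k} → Dependency k → Set₁
FirstOrder {k} D = Σ (FO (k ∷ []) 0) λ ψ → ∀ (M : Set) (R : Vec M k → Set) →
  TwoElems M → (D M R ⇔ TrueFO (structModel M R) ψ)

{-# OPTIONS --safe #-}
-- Over the vocabulary {R}, the FO(D) sentence ∀x̄ (¬R x̄ ∨ (R x̄ ∧ D x̄)) expresses
-- exactly D(R): in a splitting of the full team, the right-hand part must consist
-- of all assignments into R, so its image on x̄ is R itself. A first-order sentence
-- equivalent to it therefore defines D. Excluded middle is needed to split the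
-- full team into the assignments inside and outside R.
module Submission where

open import Defs
open import Data.Nat using (ℕ; zero; suc)
open import Level using (0ℓ)
open import Axiom.ExcludedMiddle using (ExcludedMiddle)
import Data.Fin as Fin
open import Data.List using ([]; _∷_)
open import Data.Vec using (Vec; map; allFin) renaming (lookup to vlookup; _∷_ to _∷ᵥ_)
open import Data.Vec.Properties using (map-lookup-allFin; map-id)
open import Data.Bool using (true)
open import Data.Product using (Σ; _×_; _,_; proj₁; proj₂)
open import Data.Sum using ([_,_]; swap)
open import Data.Unit using (⊤; tt)
open import Data.Empty using (⊥-elim)
open import Relation.Nullary using (¬_)
open import Relation.Nullary.Decidable using (toSum)
open import Relation.Binary.PropositionalEquality using (_≡_; refl; sym; subst)
open import Function.Base using (_∘_; id)
open import Function.Bundles using (_⇔_; mk⇔; Equivalence)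
open import Function.Construct.Identity using (↔-id)
open import Function.Construct.Composition using (_⇔-∘_)
open import Function.Construct.Symmetry using (⇔-sym)
open import Level using (lift)

IsoClosed⇒⇔-closed : ∀ {k} {D : Dependency k} → IsoClosed D →
  ∀ {M} {R R' : Vec M k → Set} → (∀ t → R t ⇔ R' t) → D M R → D M R'
IsoClosed⇒⇔-closed iso {M} {R} {R'} R⇔R' =
  iso M M (↔-id M) R R' (λ t → subst (λ u → R t ⇔ R' u) (sym (map-id t)) (R⇔R' t))

∀-closure : ∀ {σ k b} n → Fml σ k b n → Fml σ k b 0
∀-closure zero    φ = φ
∀-closure (suc n) φ = ∀-closure n (all φ)

FullTeam : ∀ {M n} → Team M n → Set
FullTeam X = ∀ s → X s

teamSat-∀-closure : ∀ {σ k} (𝓜 : Model σ) (D : Dependency k) n (φ : Fml σ k true n) (Q : Set) →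
  (∀ (Y : Team (Dom 𝓜) n) → FullTeam Y → teamSat 𝓜 D φ Y ⇔ Q) →
  ∀ (X : Team (Dom 𝓜) 0) → FullTeam X → teamSat 𝓜 D (∀-closure n φ) X ⇔ Q
teamSat-∀-closure 𝓜 D zero    φ Q full⇒Q = full⇒Q
teamSat-∀-closure 𝓜 D (suc n) φ Q full⇒Q =
  teamSat-∀-closure 𝓜 D n (all φ) Q
    (λ Y Y-full → full⇒Q _ λ { (m ∷ᵥ s) → s , Y-full s , m , refl })

image : ∀ {M k} → Team M k → Vec M k → Set
image X t = Σ _ λ s → X s × map (vlookup s) (allFin _) ≡ t

image-allFin : ∀ {M k} (X : Team M k) t → image X t ⇔ X t
image-allFin X t = mk⇔
  (λ { (s , Xs , refl) → subst X (sym (map-lookup-allFin s)) Xs })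
  (λ Xt → t , Xt , map-lookup-allFin t)

defining-formula : ∀ k → Fml (k ∷ []) k true k
defining-formula k = or (nrel Fin.zero x̄) (and (rel Fin.zero x̄) (dep x̄))
  where
  x̄ : Vec (Fin.Fin k) k
  x̄ = allFin k

module _ (lem : ExcludedMiddle 0ℓ) {k} {D : Dependency k} (iso : IsoClosed D)
         (M : Set) (R : Vec M k → Set) where

  R[_] : Vec M k → Set
  R[ s ] = R (map (vlookup s) (allFin k))

  R[]⇔R : ∀ s → R[ s ] ⇔ R s
  R[]⇔R s = mk⇔ (subst R (map-lookup-allFin s)) (subst R (sym (map-lookup-allFin s)))

  teamSat-defining-formula : (Y : Team M k) → FullTeam Y →
    teamSat (structModel M R) D (defining-formula k) Y ⇔ D M R
  teamSat-defining-formula Y Y-full = mk⇔ to from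
    where
    to : teamSat (structModel M R) D (defining-formula k) Y → D M R
    to (_ , Z , Y≡∪ , lift outside , lift inside , lift DZ) =
      IsoClosed⇒⇔-closed iso (λ t → Z⇔R t ⇔-∘ image-allFin Z t) DZ
      where
      Z⇔R : ∀ t → Z t ⇔ R t
      Z⇔R t = mk⇔ (Equivalence.to (R[]⇔R t) ∘ inside t)
        (λ Rt → [ (λ out → ⊥-elim (outside t out (Equivalence.from (R[]⇔R t) Rt))) , id ]
                  (Equivalence.to (Y≡∪ t) (Y-full t)))

    from : D M R → teamSat (structModel M R) D (defining-formula k) Y
    from DR = (λ s → ¬ R[ s ]) , R[_] ,
      (λ s → mk⇔ (λ _ → swap (toSum lem)) (λ _ → Y-full s)) ,
      lift (λ _ out → out) , lift (λ _ inside → inside) ,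
      lift (IsoClosed⇒⇔-closed iso
             (λ t → ⇔-sym (R[]⇔R t ⇔-∘ image-allFin R[_] t)) DR)

proposition3 : ExcludedMiddle 0ℓ → (k : ℕ) (D : Dependency k) →
    IsoClosed D → StronglyFO D → FirstOrder D
proposition3 lem k D iso sfo = ψ , λ M R two →
  φ⇔ψ (structModel M R) two ⇔-∘ ⇔-sym (φ⇔D M R)
  where
  φ : Fml (k ∷ []) k true 0
  φ = ∀-closure k (defining-formula k)

  ψ : FO (k ∷ []) 0
  ψ = proj₁ (sfo (k ∷ []) φ)

  φ⇔ψ : ∀ 𝓜 → TwoElems (Dom 𝓜) → TrueTeam 𝓜 D φ ⇔ TrueFO 𝓜 ψ
  φ⇔ψ = proj₂ (sfo (k ∷ []) φ)

  φ⇔D : ∀ M R → TrueTeam (structModel M R) D φ ⇔ D M R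
  φ⇔D M R = teamSat-∀-closure (structModel M R) D k (defining-formula k) (D M R)
    (teamSat-defining-formula lem iso M R) (λ _ → ⊤) (λ _ → tt)
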